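{- Let $\mathcal{C}$ be a category with finite products and weak equalisers. Then the exact completion $\mathcal{C}_{ex}$ is elemental if and only if every object of $\mathcal{C}$ is a choice object.
   Context: A weak limit is defined like a limit but without uniqueness of the mediating arrow. Global elements: an arrow $x\colon 1\to X$ is written $x\in X$. For $f\colon X\to Y$ and $y\in Y$, write $y\in_f$ if there is $x\in X$ with $fx=y$; $f$ is surjective if $y\in_f$ for all $y\in Y$. An object $Y$ is a choice object if every surjection with codomain $Y$ has a section. The terminal object is a strong generator if every arrow $f\colon X\to Y$ such that for every $y\in Y$ there is a unique $x\in X$ with $fx=y$ is an isomorphism; it is separating if any two arrows $f,g\colon X\to Y$ with $fx=gx$ for all $x\in X$ are equal. A category with a terminal object is elemental if its terminal object is a strong generator and separating. Exact completion: a pseudo-equivalence relation on $X$ in $\mathcal{C}$ is an arrow $r=\langle r_1,r_2\rangle\colon R\to X\times X$ for which there exist (not necessarily unique) arrows $\rho\colon X\to R$ with $r\rho=\langle 1_X,1_X\rangle$, $\sigma\colon R\to R$ with $r\sigma=\langle r_2,r_1\rangle$, and $\tau\colon Q\to R$ with $r\tau=\langle r_1p_1,r_2p_2\rangle$, where $(Q,p_1,p_2)$ is a weak pullback of $r_2$ and $r_1$. The category $\mathcal{C}_{ex}$ has as objects the pseudo-equivalence relations of $\mathcal{C}$; an arrow from $r\colon R\to X\times X$ to $s\colon S\to Y\times Y$ is an equivalence class $[f]$ of arrows $f\colon X\to Y$ of $\mathcal{C}$ for which some $\hat f\colon R\to S$ satisfies $s\hat f=(f\times f)r$, where $f,g$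 are identified when some $h\colon X\to S$ satisfies $sh=\langle f,g\rangle$; composition is induced by that of $\mathcal{C}$. -}

module Defs where

open import Level using (Level; _⊔_; suc)
open import Data.Product using (Σ; Σ-syntax; _×_; _,_; proj₁; proj₂)
open import Relation.Binary using (IsEquivalence)
open import Function.Bundles using (_⇔_)

-- The notions "terminal", "iso", "global
-- element", "strong generator", "separating", "elemental" only use this
-- structure.
record Precat (o ℓ e : Level) : Set (suc (o ⊔ ℓ ⊔ e)) where
  infix  4 _≈_
  infixr 9 _∘_
  field
    Obj : Set o
    Hom : Obj → Obj → Set ℓ
    _≈_ : ∀ {A B} → Hom A B → Hom A B → Set e
    id  : ∀ {A} → Hom A A
    _∘_ : ∀ {A B C} → Hom B C → Hom A B → Hom A C

record Category (o ℓ e : Level) : Set (suc (o ⊔ ℓ ⊔ e)) where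
  field
    precat : Precat o ℓ e
  open Precat precat public
  field
    equiv     : ∀ {A B} → IsEquivalence (_≈_ {A} {B})
    assoc     : ∀ {A B C D} {f : Hom A B} {g : Hom B C} {h : Hom C D} →
                (h ∘ g) ∘ f ≈ h ∘ (g ∘ f)
    identityˡ : ∀ {A B} {f : Hom A B} → id ∘ f ≈ f
    identityʳ : ∀ {A B} {f : Hom A B} → f ∘ id ≈ f
    ∘-resp-≈  : ∀ {A B C} {f h : Hom B C} {g i : Hom A B} →
                f ≈ h → g ≈ i → f ∘ g ≈ h ∘ i

module _ {o ℓ e} (C : Precat o ℓ e) where
  open Precat C

  record IsTerminal (T : Obj) : Set (o ⊔ ℓ ⊔ e) where
    field
      !      : ∀ {A} → Hom A T
      !-uniq : ∀ {A} (f g : Hom A T) → f ≈ g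

  record Terminal : Set (o ⊔ ℓ ⊔ e) where
    field
      ⊤          : Obj
      isTerminal : IsTerminal ⊤

  IsIso : ∀ {A B} → Hom A B → Set (ℓ ⊔ e)
  IsIso {A} {B} f = Σ[ g ∈ Hom B A ] (g ∘ f ≈ id × f ∘ g ≈ id)

  module _ (T : Terminal) where
    open Terminal T

    _∈_ : Obj → Set ℓ
    _∈_ X = Hom ⊤ X

    InImage : ∀ {X Y} → Hom X Y → Hom ⊤ Y → Set (ℓ ⊔ e)
    InImage {X} f y = Σ[ x ∈ Hom ⊤ X ] (f ∘ x ≈ y)

    Surjective : ∀ {X Y} → Hom X Y → Set (ℓ ⊔ e)
    Surjective {Y = Y} f = (y : Hom ⊤ Y) → InImage f y

    UniquelyHit : ∀ {X Y} → Hom X Y → Set (ℓ ⊔ e)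
    UniquelyHit {X} {Y} f =
      (y : Hom ⊤ Y) → Σ[ x ∈ Hom ⊤ X ] (f ∘ x ≈ y ×
        ((x′ : Hom ⊤ X) → f ∘ x′ ≈ y → x′ ≈ x))

    IsStrongGenerator : Set (o ⊔ ℓ ⊔ e)
    IsStrongGenerator = ∀ {X Y} (f : Hom X Y) → UniquelyHit f → IsIso f

    IsSeparating : Set (o ⊔ ℓ ⊔ e)
    IsSeparating = ∀ {X Y} (f g : Hom X Y) →
      ((x : Hom ⊤ X) → f ∘ x ≈ g ∘ x) → f ≈ g

    IsChoiceObject : Obj → Set (o ⊔ ℓ ⊔ e)
    IsChoiceObject Y = ∀ {X} (f : Hom X Y) → Surjective f →
      Σ[ s ∈ Hom Y X ] (f ∘ s ≈ id)

  Elemental : Set (o ⊔ ℓ ⊔ e)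
  Elemental = Σ[ T ∈ Terminal ] (IsStrongGenerator T × IsSeparating T)

module _ {o ℓ e} (C : Category o ℓ e) where
  open Category C

  record Product (A B : Obj) : Set (o ⊔ ℓ ⊔ e) where
    field
      A×B    : Obj
      π₁     : Hom A×B A
      π₂     : Hom A×B B
      ⟨_,_⟩  : ∀ {Z} → Hom Z A → Hom Z B → Hom Z A×B
      π₁-⟨⟩  : ∀ {Z} {f : Hom Z A} {g : Hom Z B} → π₁ ∘ ⟨ f , g ⟩ ≈ f
      π₂-⟨⟩  : ∀ {Z} {f : Hom Z A} {g : Hom Z B} → π₂ ∘ ⟨ f , g ⟩ ≈ g
      ⟨⟩-uniq : ∀ {Z} {f : Hom Z A} {g : Hom Z B} (h : Hom Z A×B) →
                π₁ ∘ h ≈ f → π₂ ∘ h ≈ g → h ≈ ⟨ f , g ⟩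

  record HasFiniteProducts : Set (o ⊔ ℓ ⊔ e) where
    field
      terminal : Terminal precat
      product  : ∀ A B → Product A B

  record WeakEqualiser {X Y : Obj} (f g : Hom X Y) : Set (o ⊔ ℓ ⊔ e) where
    field
      E     : Obj
      eq    : Hom E X
      equal : f ∘ eq ≈ g ∘ eq
      weak  : ∀ {Z} (z : Hom Z X) → f ∘ z ≈ g ∘ z → Σ[ u ∈ Hom Z E ] (eq ∘ u ≈ z)

  HasWeakEqualisers : Set (o ⊔ ℓ ⊔ e)
  HasWeakEqualisers = ∀ {X Y} (f g : Hom X Y) → WeakEqualiser f g

  record IsWeakPullback {A B X Q : Obj} (a : Hom A X) (b : Hom B X)
                        (p₁ : Hom Q A) (p₂ : Hom Q B) : Set (o ⊔ ℓ ⊔ e) where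
    field
      commute : a ∘ p₁ ≈ b ∘ p₂
      weak    : ∀ {Z} (u : Hom Z A) (v : Hom Z B) → a ∘ u ≈ b ∘ v →
                Σ[ w ∈ Hom Z Q ] (p₁ ∘ w ≈ u × p₂ ∘ w ≈ v)

module _ {o ℓ e} (C : Category o ℓ e) where
  open Category C
  open IsEquivalence

  -- A pseudo-equivalence relation r = ⟨r₁ , r₂⟩ : R → X × X, given by its
  -- two components (equalities r ρ = ⟨1,1⟩ etc. written componentwise).
  record PseudoEqRel : Set (o ⊔ ℓ ⊔ e) where
    field
      X  : Obj
      R  : Obj
      r₁ : Hom R X
      r₂ : Hom R X
      ρ  : Hom X R
      ρ₁ : r₁ ∘ ρ ≈ id
      ρ₂ : r₂ ∘ ρ ≈ id
      σ  : Hom R R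
      σ₁ : r₁ ∘ σ ≈ r₂
      σ₂ : r₂ ∘ σ ≈ r₁
      τ  : ∀ {Q} (p₁ p₂ : Hom Q R) → IsWeakPullback C r₂ r₁ p₁ p₂ →
           Σ[ t ∈ Hom Q R ] (r₁ ∘ t ≈ r₁ ∘ p₁ × r₂ ∘ t ≈ r₂ ∘ p₂)

  open PseudoEqRel

  ExHom : PseudoEqRel → PseudoEqRel → Set (ℓ ⊔ e)
  ExHom r s = Σ[ f ∈ Hom (X r) (X s) ]
              Σ[ f̂ ∈ Hom (R r) (R s) ]
                (r₁ s ∘ f̂ ≈ f ∘ r₁ r × r₂ s ∘ f̂ ≈ f ∘ r₂ r)

  ExEq : ∀ {r s} → ExHom r s → ExHom r s → Set (ℓ ⊔ e)
  ExEq {r} {s} (f , _) (g , _) =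
    Σ[ h ∈ Hom (X r) (R s) ] (r₁ s ∘ h ≈ f × r₂ s ∘ h ≈ g)

  private
    ≈-refl : ∀ {A B} {f : Hom A B} → f ≈ f
    ≈-refl = refl equiv
    ≈-sym : ∀ {A B} {f g : Hom A B} → f ≈ g → g ≈ f
    ≈-sym = sym equiv
    ≈-trans : ∀ {A B} {f g h : Hom A B} → f ≈ g → g ≈ h → f ≈ h
    ≈-trans = trans equiv

  ExId : ∀ {r} → ExHom r r
  ExId = id , id , ≈-trans identityʳ (≈-sym identityˡ)
                 , ≈-trans identityʳ (≈-sym identityˡ)

  ExComp : ∀ {r s t} → ExHom s t → ExHom r s → ExHom r t
  ExComp {r} {s} {t} (g , ĝ , g₁ , g₂) (f , f̂ , f₁ , f₂) =
    g ∘ f , ĝ ∘ f̂ , lemma g₁ f₁ , lemma g₂ f₂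
    where
    lemma : ∀ {a : Hom (R s) (X s)} {b : Hom (R r) (X r)} {c : Hom (R t) (X t)} →
            c ∘ ĝ ≈ g ∘ a → a ∘ f̂ ≈ f ∘ b → c ∘ (ĝ ∘ f̂) ≈ (g ∘ f) ∘ b
    lemma p q =
      ≈-trans (≈-sym assoc)
      (≈-trans (∘-resp-≈ p ≈-refl)
      (≈-trans assoc
      (≈-trans (∘-resp-≈ ≈-refl q)
      (≈-sym assoc))))

  Ex : Precat (o ⊔ ℓ ⊔ e) (ℓ ⊔ e) (ℓ ⊔ e)
  Ex = record
    { Obj = PseudoEqRel
    ; Hom = ExHom
    ; _≈_ = λ {r} {s} → ExEq {r} {s}
    ; id  = λ {r} → ExId {r}
    ; _∘_ = λ {r} {s} {t} → ExComp {r} {s} {t}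
    }

-- An arrow of C_ex is an arrow of C, two of
-- them are equal when they are "related" (factor jointly through the
-- relation of the codomain), and relatedness is an equivalence.
--
-- (⇐) The key fact is the POINTWISE PRINCIPLE: if X is a choice object, two
-- arrows out of X whose points are pairwise related are related.  It
-- follows from choosing a section of a weak pullback restricted to a weak
-- equaliser.  The principle gives separation by the terminal object Δ1 of
-- C_ex directly; for the strong generator property we choose a pointwise
-- inverse g of a uniquely hitting f and use the principle (with uniqueness
-- of preimages) to see that g is an arrow of C_ex inverse to f.
--
-- (⇒) For a surjection f : X → Y of C, the arrow f from the kernel pair of
-- f to the discrete relation on Y is uniquely hitting, because every arrow
-- from the terminal object of C_ex to a discrete relation is constant.  Its
-- inverse in C_ex is a section of f.

module Submission where

open import Level using (_⊔_)
open import Data.Product using (Σ-syntax; _×_; _,_; proj₁; proj₂)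
open import Function.Bundles using (_⇔_; mk⇔)
open import Relation.Binary using (IsEquivalence; Setoid)
import Relation.Binary.Reasoning.Setoid as SetoidReasoning

open import Defs

module CategoryReasoning {o ℓ e} (C : Category o ℓ e) where
  open Category C

  module ≈ {A B : Obj} = IsEquivalence (equiv {A} {B})

  hom-setoid : Obj → Obj → Setoid ℓ e
  hom-setoid A B = record { Carrier = Hom A B ; _≈_ = _≈_ ; isEquivalence = equiv }

  module HomReasoning {A B : Obj} = SetoidReasoning (hom-setoid A B)

  infixr 5 _⟫_
  _⟫_ : ∀ {A B} {f g h : Hom A B} → f ≈ g → g ≈ h → f ≈ h
  _⟫_ = ≈.trans

  refl⟩∘⟨_ : ∀ {A B D} {f : Hom B D} {g h : Hom A B} → g ≈ h → f ∘ g ≈ f ∘ h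
  refl⟩∘⟨ p = ∘-resp-≈ ≈.refl p

  _⟩∘⟨refl : ∀ {A B D} {f h : Hom B D} {g : Hom A B} → f ≈ h → f ∘ g ≈ h ∘ g
  p ⟩∘⟨refl = ∘-resp-≈ p ≈.refl

  sym-assoc : ∀ {A B D E} {f : Hom A B} {g : Hom B D} {h : Hom D E} →
              h ∘ (g ∘ f) ≈ (h ∘ g) ∘ f
  sym-assoc = ≈.sym assoc

  pullˡ : ∀ {A B D E} {f : Hom A B} {g : Hom D E} {h : Hom B D} {k : Hom B E} →
          g ∘ h ≈ k → g ∘ (h ∘ f) ≈ k ∘ f
  pullˡ p = sym-assoc ⟫ p ⟩∘⟨refl

  pullʳ : ∀ {A B D E} {f : Hom D E} {g : Hom B D} {h : Hom A B} {k : Hom A D} →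
          g ∘ h ≈ k → (f ∘ g) ∘ h ≈ f ∘ k
  pullʳ p = assoc ⟫ refl⟩∘⟨ p

module _ {o ℓ e} (C : Category o ℓ e) where
  open Category C
  open CategoryReasoning C
  module PE = PseudoEqRel

  record WeakPullback {A B Z : Obj} (a : Hom A Z) (b : Hom B Z) : Set (o ⊔ ℓ ⊔ e) where
    field
      P              : Obj
      p₁             : Hom P A
      p₂             : Hom P B
      isWeakPullback : IsWeakPullback C a b p₁ p₂
    open IsWeakPullback isWeakPullback public

  HasWeakPullbacks : Set (o ⊔ ℓ ⊔ e)
  HasWeakPullbacks = ∀ {A B Z} (a : Hom A Z) (b : Hom B Z) → WeakPullback a b

  weakPullbacks : (∀ A B → Product C A B) → HasWeakEqualisers C → HasWeakPullbacks
  weakPullbacks product weq {A} {B} a b = record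
    { P = W.E ; p₁ = π₁ ∘ W.eq ; p₂ = π₂ ∘ W.eq
    ; isWeakPullback = record { commute = sym-assoc ⟫ W.equal ⟫ assoc ; weak = factor } }
    where
    open Product (product A B)
    module W = WeakEqualiser (weq (a ∘ π₁) (b ∘ π₂))
    factor : ∀ {Z} (u : Hom Z A) (v : Hom Z B) → a ∘ u ≈ b ∘ v →
             Σ[ w ∈ Hom Z W.E ] ((π₁ ∘ W.eq) ∘ w ≈ u × (π₂ ∘ W.eq) ∘ w ≈ v)
    factor u v au≈bv
      with W.weak ⟨ u , v ⟩ (pullʳ π₁-⟨⟩ ⟫ au≈bv ⟫ ≈.sym (pullʳ π₂-⟨⟩))
    ... | w , eqw≈⟨u,v⟩ = w , pullʳ eqw≈⟨u,v⟩ ⟫ π₁-⟨⟩ , pullʳ eqw≈⟨u,v⟩ ⟫ π₂-⟨⟩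

  Related : ∀ {R Y Z} → Hom R Y → Hom R Y → Hom Z Y → Hom Z Y → Set (ℓ ⊔ e)
  Related {R} {Z = Z} r₁ r₂ u v = Σ[ h ∈ Hom Z R ] (r₁ ∘ h ≈ u × r₂ ∘ h ≈ v)

  -- Relatedness by a pseudo-equivalence relation; this is exactly the
  -- equality of arrows of C_ex into r.
  infix 4 [_]_∼_
  [_]_∼_ : ∀ {Z} (r : PseudoEqRel C) → Hom Z (PE.X r) → Hom Z (PE.X r) → Set (ℓ ⊔ e)
  [ r ] u ∼ v = Related (PE.r₁ r) (PE.r₂ r) u v

  module _ {R Y : Obj} {r₁ r₂ : Hom R Y} where
    ∼-resp-≈ : ∀ {Z} {u u′ v v′ : Hom Z Y} → u ≈ u′ → v ≈ v′ →
               Related r₁ r₂ u v → Related r₁ r₂ u′ v′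
    ∼-resp-≈ u≈u′ v≈v′ (h , h₁ , h₂) = h , h₁ ⟫ u≈u′ , h₂ ⟫ v≈v′

    ∼-∘ : ∀ {W Z} {u v : Hom Z Y} → Related r₁ r₂ u v → (a : Hom W Z) →
          Related r₁ r₂ (u ∘ a) (v ∘ a)
    ∼-∘ (h , h₁ , h₂) a = h ∘ a , pullˡ h₁ , pullˡ h₂

  module _ (r : PseudoEqRel C) where
    open PseudoEqRel r

    ∼-refl : ∀ {Z} (u : Hom Z X) → [ r ] u ∼ u
    ∼-refl u = ρ ∘ u , pullˡ ρ₁ ⟫ identityˡ , pullˡ ρ₂ ⟫ identityˡ

    ∼-sym : ∀ {Z} {u v : Hom Z X} → [ r ] u ∼ v → [ r ] v ∼ u
    ∼-sym (h , h₁ , h₂) = σ ∘ h , pullˡ σ₁ ⟫ h₂ , pullˡ σ₂ ⟫ h₁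

    ∼-trans : WeakPullback r₂ r₁ → ∀ {Z} {u v w : Hom Z X} →
              [ r ] u ∼ v → [ r ] v ∼ w → [ r ] u ∼ w
    ∼-trans W (h , h₁ , h₂) (k , k₁ , k₂) =
      let (m , p₁m≈h , p₂m≈k) = weak h k (h₂ ⟫ ≈.sym k₁)
          (t , t₁ , t₂)        = τ p₁ p₂ isWeakPullback
      in t ∘ m , pullˡ t₁ ⟫ pullʳ p₁m≈h ⟫ h₁ , pullˡ t₂ ⟫ pullʳ p₂m≈k ⟫ k₂
      where open WeakPullback W

  -- The discrete relation on Y: the embedding of C into C_ex.
  Δ : Obj → PseudoEqRel C
  Δ Y = record
    { X = Y ; R = Y ; r₁ = id ; r₂ = id
    ; ρ = id ; ρ₁ = identityˡ ; ρ₂ = identityˡ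
    ; σ = id ; σ₁ = identityˡ ; σ₂ = identityˡ
    ; τ = λ p₁ _ W → p₁ , ≈.refl , IsWeakPullback.commute W }

  Δ-∼ : ∀ {Y Z} {u v : Hom Z Y} → [ Δ Y ] u ∼ v → u ≈ v
  Δ-∼ (h , h₁ , h₂) = ≈.sym h₁ ⟫ h₂

  ≈-Δ : ∀ {Y Z} {u v : Hom Z Y} → u ≈ v → [ Δ Y ] u ∼ v
  ≈-Δ u≈v = _ , identityˡ , identityˡ ⟫ u≈v

  Δ-respects : ∀ {Y Z} (r : PseudoEqRel C) {u v : Hom Z (PE.X r)} (y : ExHom C r (Δ Y)) →
               [ r ] u ∼ v → proj₁ y ∘ u ≈ proj₁ y ∘ v
  Δ-respects r {u} {v} (y , _ , ŷ₁ , ŷ₂) (h , h₁ , h₂) = begin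
    y ∘ u                ≈⟨ refl⟩∘⟨ h₁ ⟨
    y ∘ (PE.r₁ r ∘ h)    ≈⟨ pullˡ (≈.sym ŷ₁ ⟫ ŷ₂) ⟩
    (y ∘ PE.r₂ r) ∘ h    ≈⟨ pullʳ h₂ ⟩
    y ∘ v                ∎
    where open HomReasoning

  kernel-related : ∀ {X Y Z} {f : Hom X Y} (K : WeakPullback f f) {u v : Hom Z X} →
                   f ∘ u ≈ f ∘ v → Related (WeakPullback.p₁ K) (WeakPullback.p₂ K) u v
  kernel-related K {u} {v} fu≈fv = WeakPullback.weak K u v fu≈fv

  kernelPair : ∀ {X Y} {f : Hom X Y} → WeakPullback f f → PseudoEqRel C
  kernelPair {X} {f = f} K = record
    { X = X ; R = P ; r₁ = p₁ ; r₂ = p₂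
    ; ρ = proj₁ reflexive ; ρ₁ = proj₁ (proj₂ reflexive) ; ρ₂ = proj₂ (proj₂ reflexive)
    ; σ = proj₁ symmetric ; σ₁ = proj₁ (proj₂ symmetric) ; σ₂ = proj₂ (proj₂ symmetric)
    ; τ = λ q₁ q₂ Q → kernel-related K (transitive (IsWeakPullback.commute Q)) }
    where
    open WeakPullback K
    reflexive : Related p₁ p₂ id id
    reflexive = kernel-related K ≈.refl
    symmetric : Related p₁ p₂ p₂ p₁
    symmetric = kernel-related K (≈.sym commute)
    transitive : ∀ {Q} {q₁ q₂ : Hom Q P} → p₂ ∘ q₁ ≈ p₁ ∘ q₂ →
                 f ∘ (p₁ ∘ q₁) ≈ f ∘ (p₂ ∘ q₂)
    transitive {q₁ = q₁} {q₂} p₂q₁≈p₁q₂ = begin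
      f ∘ (p₁ ∘ q₁)    ≈⟨ pullˡ commute ⟩
      (f ∘ p₂) ∘ q₁    ≈⟨ pullʳ p₂q₁≈p₁q₂ ⟩
      f ∘ (p₁ ∘ q₂)    ≈⟨ pullˡ commute ⟩
      (f ∘ p₂) ∘ q₂    ≈⟨ assoc ⟩
      f ∘ (p₂ ∘ q₂)    ∎
      where open HomReasoning

  module Points (T : Terminal precat) where
    open Terminal T
    open IsTerminal isTerminal

    section-on-locus : HasWeakEqualisers C → ∀ {A D Z} → IsChoiceObject precat T A →
      (p : Hom D A) (φ ψ : Hom D Z) →
      ((a : Hom ⊤ A) → Σ[ d ∈ Hom ⊤ D ] (p ∘ d ≈ a × φ ∘ d ≈ ψ ∘ d)) →
      Σ[ s ∈ Hom A D ] (p ∘ s ≈ id × φ ∘ s ≈ ψ ∘ s)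
    section-on-locus weq choice p φ ψ lift =
      let (c , pec≈id) = choice (p ∘ eq) surjective
      in eq ∘ c , sym-assoc ⟫ pec≈id , pullˡ equal ⟫ assoc
      where
      open WeakEqualiser (weq φ ψ)
      surjective : Surjective precat T (p ∘ eq)
      surjective a with lift a
      ... | d , pd≈a , φd≈ψd with weak d φd≈ψd
      ... | w , eqw≈d = w , pullʳ eqw≈d ⟫ pd≈a

    pointwise-related : HasWeakPullbacks → HasWeakEqualisers C →
      ∀ {X R Y} → IsChoiceObject precat T X → {r₁ r₂ : Hom R Y} {u v : Hom X Y} →
      ((a : Hom ⊤ X) → Related r₁ r₂ (u ∘ a) (v ∘ a)) → Related r₁ r₂ u v
    pointwise-related wpb weq choice {r₁} {r₂} {u} {v} related =
      let (s , p₁s≈id , on-locus) = section-on-locus weq choice p₁ (v ∘ p₁) (r₂ ∘ p₂) lift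
      in p₂ ∘ s
         , pullˡ (≈.sym commute) ⟫ pullʳ p₁s≈id ⟫ identityʳ
         , sym-assoc ⟫ ≈.sym on-locus ⟫ pullʳ p₁s≈id ⟫ identityʳ
      where
      open WeakPullback (wpb u r₁)
      -- a point a, with witness k of its relatedness, lifts to ⟨a , k⟩ in P
      lift : (a : Hom ⊤ _) → Σ[ d ∈ Hom ⊤ P ] (p₁ ∘ d ≈ a × (v ∘ p₁) ∘ d ≈ (r₂ ∘ p₂) ∘ d)
      lift a with related a
      ... | k , k₁ , k₂ with weak a k (≈.sym k₁)
      ... | d , p₁d≈a , p₂d≈k = d , p₁d≈a , pullʳ p₁d≈a ⟫ ≈.sym k₂ ⟫ ≈.sym (pullʳ p₂d≈k)

    Ex-terminal : Terminal (Ex C)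
    Ex-terminal = record
      { ⊤ = Δ ⊤
      ; isTerminal = record
        { ! = ! , ! , !-uniq _ _ , !-uniq _ _
        ; !-uniq = λ _ _ → ! , !-uniq _ _ , !-uniq _ _ } }

    point : (r : PseudoEqRel C) → Hom ⊤ (PE.X r) → ExHom C (Δ ⊤) r
    point r a = a , ρ ∘ a , respects ρ₁ , respects ρ₂
      where
      open PseudoEqRel r
      respects : ∀ {rᵢ : Hom R X} → rᵢ ∘ ρ ≈ id → rᵢ ∘ (ρ ∘ a) ≈ a ∘ id
      respects rᵢρ≈id = pullˡ rᵢρ≈id ⟫ identityˡ ⟫ ≈.sym identityʳ

    constant : (r s : PseudoEqRel C) → Hom ⊤ (PE.X s) → ExHom C r s
    constant r s y = y ∘ ! , ρ ∘ (y ∘ !) , respects ρ₁ , respects ρ₂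
      where
      open PseudoEqRel s
      respects : ∀ {sᵢ : Hom R X} {rᵢ : Hom (PE.R r) (PE.X r)} →
                 sᵢ ∘ ρ ≈ id → sᵢ ∘ (ρ ∘ (y ∘ !)) ≈ (y ∘ !) ∘ rᵢ
      respects sᵢρ≈id = pullˡ sᵢρ≈id ⟫ identityˡ ⟫ ≈.sym (pullʳ (!-uniq _ _))

  module ChoiceImpliesElemental (T : Terminal precat) (wpb : HasWeakPullbacks)
      (weq : HasWeakEqualisers C) (choice : ∀ Y → IsChoiceObject precat T Y) where
    open Terminal T
    open Points T

    pointwise-∼ : ∀ {Z} (r : PseudoEqRel C) {u v : Hom Z (PE.X r)} →
                  ((a : Hom ⊤ Z) → [ r ] u ∘ a ∼ v ∘ a) → [ r ] u ∼ v
    pointwise-∼ r = pointwise-related wpb weq (choice _)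

    separating : IsSeparating (Ex C) Ex-terminal
    separating {r} {s} (f , _) (g , _) agree = pointwise-∼ s (λ a → agree (point r a))

    pointwise-ExHom : ∀ {r s} (g : Hom (PE.X r) (PE.X s)) →
      ((z : Hom ⊤ (PE.R r)) → [ s ] g ∘ (PE.r₁ r ∘ z) ∼ g ∘ (PE.r₂ r ∘ z)) → ExHom C r s
    pointwise-ExHom {r} {s} g respects =
      let (ĝ , ĝ₁ , ĝ₂) = pointwise-∼ s {u = g ∘ PE.r₁ r} {v = g ∘ PE.r₂ r}
                            (λ z → ∼-resp-≈ sym-assoc sym-assoc (respects z))
      in g , ĝ , ĝ₁ , ĝ₂

    module UniquelyHitIsIso {r s : PseudoEqRel C} (f : ExHom C r s)
        (hit : UniquelyHit (Ex C) Ex-terminal {r} {s} f) where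
      module r = PseudoEqRel r
      module s = PseudoEqRel s
      open WeakPullback (wpb (proj₁ f) s.r₁)

      preimage-unique : ∀ {a b : Hom ⊤ r.X} {y : Hom ⊤ s.X} →
        [ s ] proj₁ f ∘ a ∼ y → [ s ] proj₁ f ∘ b ∼ y → [ r ] a ∼ b
      preimage-unique {a} {b} {y} fa∼y fb∼y =
        let (_ , _ , unique) = hit (point s y)
        in ∼-trans r (wpb _ _) (unique (point r a) fa∼y)
                               (∼-sym r (unique (point r b) fb∼y))

      r₂p₂-surjective : Surjective precat T (s.r₂ ∘ p₂)
      r₂p₂-surjective y with hit (point s y)
      ... | (x , _) , (h , h₁ , h₂) , _ with weak x h (≈.sym h₁)
      ... | d , _ , p₂d≈h = d , pullʳ p₂d≈h ⟫ h₂

      section : Σ[ c ∈ Hom s.X P ] ((s.r₂ ∘ p₂) ∘ c ≈ id)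
      section = choice s.X (s.r₂ ∘ p₂) r₂p₂-surjective

      g : Hom s.X r.X
      g = p₁ ∘ proj₁ section

      fg∼id : [ s ] proj₁ f ∘ g ∼ id
      fg∼id = p₂ ∘ proj₁ section
            , pullˡ (≈.sym commute) ⟫ assoc
            , sym-assoc ⟫ proj₂ section

      fg-point : ∀ {Z} (y : Hom Z s.X) → [ s ] proj₁ f ∘ (g ∘ y) ∼ y
      fg-point y = ∼-resp-≈ assoc identityˡ (∼-∘ fg∼id y)

      -- g respects the relations: for a point z of s.R, f g (s.r₁ z) and
      -- f g (s.r₂ z) are both related to s.r₂ z
      gₑₓ : ExHom C s r
      gₑₓ = pointwise-ExHom {s} {r} g λ z →
        preimage-unique (∼-trans s (wpb _ _) (fg-point (s.r₁ ∘ z)) (z , ≈.refl , ≈.refl))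
                        (fg-point (s.r₂ ∘ z))

      -- g (f a) and a are both preimages of f a, hence related
      gf∼id : [ r ] g ∘ proj₁ f ∼ id
      gf∼id = pointwise-∼ r λ a →
        ∼-resp-≈ sym-assoc (≈.sym identityˡ)
          (preimage-unique (fg-point (proj₁ f ∘ a)) (∼-refl s (proj₁ f ∘ a)))

      iso : IsIso (Ex C) {r} {s} f
      iso = gₑₓ , gf∼id , fg∼id

    strong-generator : IsStrongGenerator (Ex C) Ex-terminal
    strong-generator {r} {s} f hit = UniquelyHitIsIso.iso {r} {s} f hit

    elemental : Elemental (Ex C)
    elemental = Ex-terminal , (λ {r} {s} → strong-generator {r} {s})
                            , (λ {r} {s} → separating {r} {s})

  module StrongGeneratorImpliesChoice (T : Terminal precat) (wpb : HasWeakPullbacks)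
      (Tₑₓ : Terminal (Ex C)) (strong : IsStrongGenerator (Ex C) Tₑₓ) where
    open Terminal T
    open IsTerminal isTerminal
    open Points T
    module Tₑₓ = Terminal Tₑₓ
    module 𝟙 = PseudoEqRel Tₑₓ.⊤

    t : Hom ⊤ 𝟙.X
    t = proj₁ (IsTerminal.! Tₑₓ.isTerminal {Δ ⊤})

    contractible : [ Tₑₓ.⊤ ] id ∼ t ∘ !
    contractible = IsTerminal.!-uniq Tₑₓ.isTerminal {Tₑₓ.⊤}
                     (ExId C {Tₑₓ.⊤}) (constant Tₑₓ.⊤ Tₑₓ.⊤ t)

    factors-through-t : ∀ {Y} (y : ExHom C Tₑₓ.⊤ (Δ Y)) → proj₁ y ≈ (proj₁ y ∘ t) ∘ !
    factors-through-t y = ≈.sym identityʳ ⟫ Δ-respects Tₑₓ.⊤ y contractible ⟫ sym-assoc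

    choice : ∀ Y → IsChoiceObject precat T Y
    choice Y {X} f surjective =
      let (g , _) , _ , fg∼id = strong {kernelPair K} {Δ Y} fₑₓ uniquelyHit
      in g , Δ-∼ fg∼id
      where
      K : WeakPullback f f
      K = wpb f f

      fₑₓ : ExHom C (kernelPair K) (Δ Y)
      fₑₓ = f , f ∘ WeakPullback.p₁ K , identityˡ , identityˡ ⟫ WeakPullback.commute K

      -- the preimage of y is the constant arrow at a preimage of y t
      uniquelyHit : UniquelyHit (Ex C) Tₑₓ {kernelPair K} {Δ Y} fₑₓ
      uniquelyHit y =
        let (x , fx≈yt) = surjective (proj₁ y ∘ t)
            fx!≈y : f ∘ (x ∘ !) ≈ proj₁ y
            fx!≈y = sym-assoc ⟫ fx≈yt ⟩∘⟨refl ⟫ ≈.sym (factors-through-t y)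
        in constant Tₑₓ.⊤ (kernelPair K) x
         , ≈-Δ fx!≈y
         , λ x′ fx′∼y → kernel-related K (Δ-∼ fx′∼y ⟫ ≈.sym fx!≈y)

theorem3p12 : ∀ {o ℓ e} (C : Category o ℓ e) (prod : HasFiniteProducts C) →
              HasWeakEqualisers C →
              (Elemental (Ex C) ⇔
                (∀ (Y : Category.Obj C) →
                   IsChoiceObject (Category.precat C) (HasFiniteProducts.terminal prod) Y))
theorem3p12 C prod weq = mk⇔
  (λ (Tₑₓ , strong , _) → StrongGeneratorImpliesChoice.choice C terminal wpb Tₑₓ
                                  (λ {r} {s} → strong {r} {s}))
  (λ choice → ChoiceImpliesElemental.elemental C terminal wpb weq choice)
  where
  open HasFiniteProducts prod
  wpb : HasWeakPullbacks C
  wpb = weakPullbacks C product weq
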